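{- Let $M$ be an abelian group and let $A,B\subseteq M$ be subgroups. Assume that $B$ is $A$-normal in $A+B$. Then the natural restriction map $\mathrm{Aut}_{A\cap B}(A+B)\to\mathrm{Aut}_{A\cap B}(B)$ induces an isomorphism $\mathrm{Aut}_A(A+B)\cong\mathrm{Aut}_{A\cap B}(B)$.
   Context: For abelian groups $X\subseteq Y$, $\mathrm{Aut}_X(Y)$ is the group of automorphisms of $Y$ restricting to the identity on $X$. For $A\subseteq D\subseteq N$, $D$ is $A$-normal in $N$ if every element of $\mathrm{Aut}_A(N)$ maps $D$ into itself; for a subgroup $D'\subseteq N$ not necessarily containing $A$, $D'$ is $A$-normal in $N$ if $D'$ is $(A\cap D')$-normal in $A+D'$ and $A+D'$ is $A$-normal in $N$. In particular, the hypothesis implies that restriction to $B$ maps $\mathrm{Aut}_{A\cap B}(A+B)$ into $\mathrm{Aut}_{A\cap B}(B)$. -}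

module Defs where

open import Level using (Level; _⊔_; suc)
open import Algebra.Bundles using (AbelianGroup)
open import Data.Product using (Σ; ∃; ∃-syntax; _×_; _,_; proj₁; proj₂)

module _ {c ℓ : Level} (G : AbelianGroup c ℓ) where
  open AbelianGroup G

  record Subgroup (p : Level) : Set (c ⊔ ℓ ⊔ suc p) where
    field
      mem   : Carrier → Set p
      resp  : ∀ {x y} → x ≈ y → mem x → mem y
      ε∈    : mem ε
      ∙∈    : ∀ {x y} → mem x → mem y → mem (x ∙ y)
      ⁻¹∈   : ∀ {x} → mem x → mem (x ⁻¹)
  open Subgroup public

  _⊕_ : ∀ {p} → Subgroup p → Subgroup p → Carrier → Set (c ⊔ ℓ ⊔ p)
  (A ⊕ B) x = ∃[ a ] ∃[ b ] (mem A a × mem B b × x ≈ a ∙ b)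

  _⊓_ : ∀ {p} → Subgroup p → Subgroup p → Carrier → Set p
  (A ⊓ B) x = mem A x × mem B x

  Elt : ∀ {q} → (Carrier → Set q) → Set (c ⊔ q)
  Elt Y = Σ Carrier Y

  record Aut {q} (Y : Carrier → Set q) : Set (c ⊔ ℓ ⊔ q) where
    field
      fun   : Elt Y → Elt Y
      inv   : Elt Y → Elt Y
      fun-cong : ∀ u v → proj₁ u ≈ proj₁ v → proj₁ (fun u) ≈ proj₁ (fun v)
      inv-cong : ∀ u v → proj₁ u ≈ proj₁ v → proj₁ (inv u) ≈ proj₁ (inv v)
      hom   : ∀ x y (px : Y x) (py : Y y) (pxy : Y (x ∙ y)) →
              proj₁ (fun (x ∙ y , pxy)) ≈ proj₁ (fun (x , px)) ∙ proj₁ (fun (y , py))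
      fun-inv : ∀ u → proj₁ (fun (inv u)) ≈ proj₁ u
      inv-fun : ∀ u → proj₁ (inv (fun u)) ≈ proj₁ u
  open Aut public

  AutOver : ∀ {q r} → (Carrier → Set r) → (Carrier → Set q) → Set (c ⊔ ℓ ⊔ q ⊔ r)
  AutOver X Y = Σ (Aut Y) λ φ → ∀ x (px : Y x) → X x → proj₁ (fun φ (x , px)) ≈ x

  app : ∀ {q r} {X : Carrier → Set r} {Y : Carrier → Set q} →
        AutOver X Y → Elt Y → Carrier
  app φ u = proj₁ (fun (proj₁ φ) u)

  -- For A ⊆ D ⊆ N: D is A-normal in N if every element of Aut_A(N) maps D into D.
  NormalOver : ∀ {q r s} → (Carrier → Set r) → (Carrier → Set s) → (Carrier → Set q) →
               Set (c ⊔ ℓ ⊔ q ⊔ r ⊔ s)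
  NormalOver A D N = ∀ (φ : AutOver A N) x (px : N x) → D x → D (app φ (x , px))

  IsANormal : ∀ {p q} → Subgroup p → Subgroup p → (Carrier → Set q) → Set (c ⊔ ℓ ⊔ p ⊔ q)
  IsANormal A D' N = NormalOver (A ⊓ D') (mem D') (A ⊕ D') × NormalOver (mem A) (A ⊕ D') N

-- An automorphism of A + B fixing A is determined by its restriction to B,
-- and A-normality of B makes that restriction an automorphism of B fixing
-- A ∩ B.  Conversely θ ∈ Aut_{A∩B}(B) extends to A + B by a + b ↦ a + θ b:
-- two decompositions a + b = a' + b' differ by d = b' - b = a - a', which
-- lies in A ∩ B and is therefore fixed by θ, so the extension is well defined.
module Submission where

open import Defs
open import Level using (Level; _⊔_)
open import Algebra.Bundles using (AbelianGroup)
open import Data.Product using (Σ; ∃; ∃-syntax; _×_; _,_; proj₁; proj₂)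
import Algebra.Properties.AbelianGroup as AbelianGroupProperties
import Algebra.Properties.CommutativeSemigroup as CommutativeSemigroupProperties
import Relation.Binary.Reasoning.Setoid as SetoidReasoning

module _ {c ℓ : Level} (G : AbelianGroup c ℓ) where
  open AbelianGroup G
  open AbelianGroupProperties G using (\\-leftDividesʳ; //-rightDividesˡ; //-rightDividesʳ)
  open CommutativeSemigroupProperties commutativeSemigroup using (interchange)
  open SetoidReasoning setoid

  Closed : ∀ {q} → (Carrier → Set q) → Set (c ⊔ q)
  Closed Y = ∀ {x y} → Y x → Y y → Y (x ∙ y)

  module _ {q r} {X : Carrier → Set r} {Y : Carrier → Set q} where

    app-irrelevant : (φ : AutOver G X Y) → ∀ x (px qx : Y x) → app G φ (x , px) ≈ app G φ (x , qx)
    app-irrelevant φ x px qx = fun-cong (proj₁ φ) (x , px) (x , qx) refl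

    fun-injective : (f : Aut G Y) → ∀ u v → proj₁ (fun f u) ≈ proj₁ (fun f v) → proj₁ u ≈ proj₁ v
    fun-injective f u v e = begin
      proj₁ u                 ≈⟨ inv-fun f u ⟨
      proj₁ (inv f (fun f u)) ≈⟨ inv-cong f (fun f u) (fun f v) e ⟩
      proj₁ (inv f (fun f v)) ≈⟨ inv-fun f v ⟩
      proj₁ v                 ∎

    AutOver-inverse : Closed Y → AutOver G X Y → AutOver G X Y
    AutOver-inverse Y-closed (f , f-fixes-X) = f⁻¹ , f⁻¹-fixes-X
      where
      f⁻¹ : Aut G Y
      f⁻¹ = record
        { fun = inv f ; inv = fun f
        ; fun-cong = inv-cong f ; inv-cong = fun-cong f
        ; hom = λ x y px py pxy →
            let x' = inv f (x , px) ; y' = inv f (y , py)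
                x'y' = proj₁ x' ∙ proj₁ y' , Y-closed (proj₂ x') (proj₂ y')
            in fun-injective f (inv f (x ∙ y , pxy)) x'y' (begin
              proj₁ (fun f (inv f (x ∙ y , pxy)))  ≈⟨ fun-inv f _ ⟩
              x ∙ y                                ≈⟨ ∙-cong (fun-inv f _) (fun-inv f _) ⟨
              proj₁ (fun f x') ∙ proj₁ (fun f y')  ≈⟨ hom f _ _ (proj₂ x') (proj₂ y') _ ⟨
              proj₁ (fun f x'y')                   ∎)
        ; fun-inv = inv-fun f ; inv-fun = fun-inv f
        }

      f⁻¹-fixes-X : ∀ x (px : Y x) → X x → proj₁ (inv f (x , px)) ≈ x
      f⁻¹-fixes-X x px Xx = begin
        proj₁ (inv f (x , px))         ≈⟨ inv-cong f (x , px) (fun f (x , px)) (sym (f-fixes-X x px Xx)) ⟩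
        proj₁ (inv f (fun f (x , px))) ≈⟨ inv-fun f _ ⟩
        x                              ∎

    AutOver-mono : ∀ {s} {X' : Carrier → Set s} → (∀ {x} → X' x → X x) →
                   AutOver G X Y → AutOver G X' Y
    AutOver-mono X'⊆X (f , f-fixes-X) = f , λ x px X'x → f-fixes-X x px (X'⊆X X'x)

  module Restriction {q r s} {X : Carrier → Set r} {Y : Carrier → Set q} {Z : Carrier → Set s}
                     (Z⊆Y : ∀ {x} → Z x → Y x) (Y-closed : Closed Y)
                     (Z-normal : NormalOver G X Z Y) where

    restrict : AutOver G X Y → AutOver G X Z
    restrict φ@(f , f-fixes-X) = f∣Z , λ x pz → f-fixes-X x (Z⊆Y pz)
      where
      φ⁻¹ = AutOver-inverse Y-closed φ

      restrictFun : AutOver G X Y → Elt G Z → Elt G Z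
      restrictFun ψ (x , pz) = app G ψ (x , Z⊆Y pz) , Z-normal ψ x (Z⊆Y pz) pz

      f∣Z : Aut G Z
      f∣Z = record
        { fun = restrictFun φ ; inv = restrictFun φ⁻¹
        ; fun-cong = λ u v → fun-cong f _ _
        ; inv-cong = λ u v → inv-cong f _ _
        ; hom = λ x y px py pxy → hom f x y (Z⊆Y px) (Z⊆Y py) (Z⊆Y pxy)
        ; fun-inv = λ u → trans (fun-cong f _ (inv f (proj₁ u , Z⊆Y (proj₂ u))) refl) (fun-inv f _)
        ; inv-fun = λ u → trans (inv-cong f _ (fun f (proj₁ u , Z⊆Y (proj₂ u))) refl) (inv-fun f _)
        }

    restrict-app : ∀ φ x (pz : Z x) (py : Y x) → app G (restrict φ) (x , pz) ≈ app G φ (x , py)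
    restrict-app φ x pz = app-irrelevant φ x (Z⊆Y pz)

    restrict-∘ : ∀ φ ψ χ → (∀ u → app G χ u ≈ app G φ (fun (proj₁ ψ) u)) →
                 ∀ v → app G (restrict χ) v ≈ app G (restrict φ) (fun (proj₁ (restrict ψ)) v)
    restrict-∘ φ ψ χ χ≈φ∘ψ (x , pz) =
      trans (χ≈φ∘ψ (x , Z⊆Y pz)) (app-irrelevant φ (app G ψ (x , Z⊆Y pz)) _ _)

  module _ {p} (A B : Subgroup G p) where

    A+B : Carrier → Set (c ⊔ ℓ ⊔ p)
    A+B = _⊕_ G A B

    A∩B : Carrier → Set p
    A∩B = _⊓_ G A B

    ⊕-closed : Closed A+B
    ⊕-closed (a , b , pa , pb , e) (a' , b' , pa' , pb' , e') =
      a ∙ a' , b ∙ b' , ∙∈ A pa pa' , ∙∈ B pb pb' , trans (∙-cong e e') (interchange a b a' b')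

    ⊆-⊕ˡ : ∀ {x} → mem A x → A+B x
    ⊆-⊕ˡ {x} px = x , ε , px , ε∈ B , sym (identityʳ x)

    ⊆-⊕ʳ : ∀ {x} → mem B x → A+B x
    ⊆-⊕ʳ {x} px = ε , x , ε∈ A , px , sym (identityˡ x)

    AutOver-A-determined-by-B : ∀ (φ ψ : AutOver G (mem A) A+B) →
      (∀ b (pb : mem B b) → app G φ (b , ⊆-⊕ʳ pb) ≈ app G ψ (b , ⊆-⊕ʳ pb)) →
      ∀ u → app G φ u ≈ app G ψ u
    AutOver-A-determined-by-B φ ψ φ≈ψ-on-B (x , ab@(a , b , pa , pb , x≈a∙b)) = begin
      app G φ (x , ab)            ≈⟨ fun-cong (proj₁ φ) _ (a ∙ b , pab) x≈a∙b ⟩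
      app G φ (a ∙ b , pab)       ≈⟨ hom (proj₁ φ) a b a∈ b∈ pab ⟩
      app G φ (a , a∈) ∙ app G φ (b , b∈)
                                  ≈⟨ ∙-cong (proj₂ φ a a∈ pa) (φ≈ψ-on-B b pb) ⟩
      a ∙ app G ψ (b , b∈)        ≈⟨ ∙-congʳ (proj₂ ψ a a∈ pa) ⟨
      app G ψ (a , a∈) ∙ app G ψ (b , b∈)
                                  ≈⟨ hom (proj₁ ψ) a b a∈ b∈ pab ⟨
      app G ψ (a ∙ b , pab)       ≈⟨ fun-cong (proj₁ ψ) _ (a ∙ b , pab) x≈a∙b ⟨
      app G ψ (x , ab)            ∎
      where
      pab = a , b , pa , pb , refl
      a∈ = ⊆-⊕ˡ pa
      b∈ = ⊆-⊕ʳ pb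

    extend-wd : (θ : AutOver G A∩B (mem B)) →
                ∀ {a b a' b'} (pa : mem A a) (pb : mem B b) (pa' : mem A a') (pb' : mem B b') →
                a ∙ b ≈ a' ∙ b' → a ∙ app G θ (b , pb) ≈ a' ∙ app G θ (b' , pb')
    extend-wd θ {a} {b} {a'} {b'} pa pb pa' pb' a∙b≈a'∙b' = sym (begin
      a' ∙ app G θ (b' , pb')      ≈⟨ ∙-congˡ (fun-cong (proj₁ θ) (b' , pb') (d ∙ b , ∙∈ B pd pb)
                                                (sym (//-rightDividesˡ b b'))) ⟩
      a' ∙ app G θ (d ∙ b , _)     ≈⟨ ∙-congˡ (hom (proj₁ θ) d b pd pb _) ⟩
      a' ∙ (app G θ (d , pd) ∙ θb) ≈⟨ ∙-congˡ (∙-congʳ (proj₂ θ d pd (d∈A , pd))) ⟩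
      a' ∙ (d ∙ θb)                ≈⟨ assoc a' d θb ⟨
      (a' ∙ d) ∙ θb                ≈⟨ ∙-congʳ a'∙d≈a ⟩
      a ∙ θb                       ∎)
      where
      θb = app G θ (b , pb)
      d = b' ∙ b ⁻¹
      pd = ∙∈ B pb' (⁻¹∈ B pb)
      a'∙d≈a : a' ∙ d ≈ a
      a'∙d≈a = begin
        a' ∙ (b' ∙ b ⁻¹) ≈⟨ assoc a' b' (b ⁻¹) ⟨
        (a' ∙ b') ∙ b ⁻¹ ≈⟨ ∙-congʳ a∙b≈a'∙b' ⟨
        (a ∙ b) ∙ b ⁻¹   ≈⟨ //-rightDividesʳ b a ⟩
        a                ∎
      d∈A : mem A d
      d∈A = resp A (trans (∙-congˡ (sym a'∙d≈a)) (\\-leftDividesʳ a' d)) (∙∈ A (⁻¹∈ A pa') pa)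

    extendFun : AutOver G A∩B (mem B) → Elt G A+B → Elt G A+B
    extendFun θ (x , (a , b , pa , pb , _)) = a ∙ proj₁ θb , (a , proj₁ θb , pa , proj₂ θb , refl)
      where θb = fun (proj₁ θ) (b , pb)

    extendFun-cong : ∀ θ u v → proj₁ u ≈ proj₁ v → proj₁ (extendFun θ u) ≈ proj₁ (extendFun θ v)
    extendFun-cong θ (x , (a , b , pa , pb , x≈a∙b)) (y , (a' , b' , pa' , pb' , y≈a'∙b')) x≈y =
      extend-wd θ pa pb pa' pb' (trans (sym x≈a∙b) (trans x≈y y≈a'∙b'))

    extendFun-inverse : ∀ θ θ' → (∀ v → proj₁ (fun (proj₁ θ) (fun (proj₁ θ') v)) ≈ proj₁ v) →
                        ∀ u → proj₁ (extendFun θ (extendFun θ' u)) ≈ proj₁ u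
    extendFun-inverse θ θ' θ∘θ'≈id (x , (a , b , pa , pb , x≈a∙b)) =
      trans (∙-congˡ (θ∘θ'≈id (b , pb))) (sym x≈a∙b)

    extend : AutOver G A∩B (mem B) → AutOver G (mem A) A+B
    extend θ = record
      { fun = extendFun θ ; inv = extendFun θ⁻¹
      ; fun-cong = extendFun-cong θ ; inv-cong = extendFun-cong θ⁻¹
      ; hom = extendFun-hom
      ; fun-inv = extendFun-inverse θ θ⁻¹ (fun-inv (proj₁ θ))
      ; inv-fun = extendFun-inverse θ⁻¹ θ (inv-fun (proj₁ θ))
      }
      , extendFun-fixes-A
      where
      θ⁻¹ = AutOver-inverse (∙∈ B) θ
      θ[_] : ∀ {b} → mem B b → Carrier
      θ[ pb ] = app G θ (_ , pb)

      extendFun-hom : ∀ x y (px : A+B x) (py : A+B y) (pxy : A+B (x ∙ y)) →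
        proj₁ (extendFun θ (x ∙ y , pxy)) ≈
        proj₁ (extendFun θ (x , px)) ∙ proj₁ (extendFun θ (y , py))
      extendFun-hom x y (ax , bx , pax , pbx , x≈) (ay , by , pay , pby , y≈) (a , b , pa , pb , xy≈) =
        begin
        a ∙ θ[ pb ]                       ≈⟨ extend-wd θ pa pb (∙∈ A pax pay) (∙∈ B pbx pby) decomposed ⟩
        (ax ∙ ay) ∙ θ[ ∙∈ B pbx pby ]     ≈⟨ ∙-congˡ (hom (proj₁ θ) bx by pbx pby _) ⟩
        (ax ∙ ay) ∙ (θ[ pbx ] ∙ θ[ pby ]) ≈⟨ interchange ax ay _ _ ⟩
        (ax ∙ θ[ pbx ]) ∙ (ay ∙ θ[ pby ]) ∎
        where
        decomposed : a ∙ b ≈ (ax ∙ ay) ∙ (bx ∙ by)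
        decomposed = trans (sym xy≈) (trans (∙-cong x≈ y≈) (interchange ax bx ay by))

      extendFun-fixes-A : ∀ x (px : A+B x) → mem A x → proj₁ (extendFun θ (x , px)) ≈ x
      extendFun-fixes-A x (a , b , pa , pb , x≈a∙b) x∈A = begin
        a ∙ θ[ pb ] ≈⟨ ∙-congˡ (proj₂ θ b pb (b∈A , pb)) ⟩
        a ∙ b       ≈⟨ x≈a∙b ⟨
        x           ∎
        where b∈A = resp A (trans (∙-congˡ x≈a∙b) (\\-leftDividesʳ a b)) (∙∈ A (⁻¹∈ A pa) x∈A)

    extend-on-B : ∀ θ b (pb : mem B b) → app G (extend θ) (b , ⊆-⊕ʳ pb) ≈ app G θ (b , pb)
    extend-on-B θ b pb = identityˡ _

lemma2p8 : ∀ {c ℓ p : Level} (G : AbelianGroup c ℓ) (A B : Subgroup G p) →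
    IsANormal G A B (_⊕_ G A B) →
    let open AbelianGroup G in
    Σ (AutOver G (mem A) (_⊕_ G A B) → AutOver G (_⊓_ G A B) (mem B)) λ R →
    (∀ φ x (px : mem B x) (qx : _⊕_ G A B x) → app G (R φ) (x , px) ≈ app G φ (x , qx))
    × (∀ φ ψ χ → (∀ u → app G χ u ≈ app G φ (fun (proj₁ ψ) u)) →
    ∀ v → app G (R χ) v ≈ app G (R φ) (fun (proj₁ (R ψ)) v))
    × (∀ φ ψ → (∀ v → app G (R φ) v ≈ app G (R ψ) v) → ∀ u → app G φ u ≈ app G ψ u)
    × (∀ (θ : AutOver G (_⊓_ G A B) (mem B)) → ∃[ φ ] (∀ v → app G (R φ) v ≈ app G θ v))
lemma2p8 G A B (B-normal , _) =
    R
  , (λ φ → restrict-app (fix-A∩B φ))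
  , (λ φ ψ χ → restrict-∘ (fix-A∩B φ) (fix-A∩B ψ) (fix-A∩B χ))
  , (λ φ ψ R⟨φ⟩≈R⟨ψ⟩ → AutOver-A-determined-by-B G A B φ ψ (λ b pb → R⟨φ⟩≈R⟨ψ⟩ (b , pb)))
  , λ θ → extend G A B θ , λ (b , pb) → extend-on-B G A B θ b pb
  where
  open Restriction G (⊆-⊕ʳ G A B) (⊕-closed G A B) B-normal

  fix-A∩B : AutOver G (mem A) (A+B G A B) → AutOver G (A∩B G A B) (A+B G A B)
  fix-A∩B = AutOver-mono G proj₁

  R : AutOver G (mem A) (A+B G A B) → AutOver G (A∩B G A B) (mem B)
  R φ = restrict (fix-A∩B φ)
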